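{- For every $\alpha\in\mathbb N=\{1,2,\dots\}$ and $n\ge0$, $$\det\left(\frac{1}{F_{\alpha+i+j}}\right)_{i,j=0}^n=\left((-1)^{\alpha\binom{n+1}{2}}F_\alpha\prod_{k=1}^n F_{\alpha+2k}\binom{\alpha+2k-1}{k}_{\mathbb F}^2\right)^{ -1},$$ which is the reciprocal of an integer.
   Context: $F_n$ denotes the Fibonacci numbers: $F_0=0$, $F_1=1$, $F_{n+1}=F_n+F_{n-1}$. The Fibonomial coefficients are $\binom{n}{k}_{\mathbb F}=\prod_{i=1}^k\frac{F_{n-i+1}}{F_i}$ for $0\le k\le n$ (empty product $=1$). -}

module Defs where

open import Data.Nat as ℕ using (ℕ; zero; suc)
open import Data.Nat.Combinatorics using (_C_)
open import Data.Integer as ℤ using (ℤ; +_)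
open import Data.Rational as ℚ using (ℚ; 0ℚ; 1ℚ; _*_; _+_; -_)
open import Data.Fin using (Fin; zero; suc; punchIn; toℕ)

F : ℕ → ℕ
F zero = 0
F (suc zero) = 1
F (suc (suc n)) = F (suc n) ℕ.+ F n

ℕ→ℚ : ℕ → ℚ
ℕ→ℚ m = (+ m) ℚ./ 1

-- reciprocal of a natural number; convention 1/0 := 0 (only ever applied to
-- positive arguments below)
recip : ℕ → ℚ
recip zero = 0ℚ
recip (suc m) = (+ 1) ℚ./ (suc m)

prod1 : ℕ → (ℕ → ℚ) → ℚ
prod1 zero f = 1ℚ
prod1 (suc k) f = prod1 k f * f (suc k)

fibonomial : ℕ → ℕ → ℚ
fibonomial n k = prod1 k (λ i → ℕ→ℚ (F (n ℕ.∸ i ℕ.+ 1)) * recip (F i))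

sgn : ℕ → ℚ
sgn zero = 1ℚ
sgn (suc m) = - sgn m

sumFin : ∀ {n} → (Fin n → ℚ) → ℚ
sumFin {zero} f = 0ℚ
sumFin {suc n} f = f zero + sumFin (λ i → f (suc i))

det : ∀ n → (Fin n → Fin n → ℚ) → ℚ
det zero M = 1ℚ
det (suc n) M =
  sumFin (λ j → sgn (toℕ j) * (M zero j * det n (λ i k → M (suc i) (punchIn j k))))

hankelMatrix : ℕ → (n : ℕ) → Fin (suc n) → Fin (suc n) → ℚ
hankelMatrix α n i j = recip (F (α ℕ.+ toℕ i ℕ.+ toℕ j))

rhsDenominator : ℕ → ℕ → ℚ
rhsDenominator α n =
  sgn (α ℕ.* (suc n C 2)) * (ℕ→ℚ (F α) *
    prod1 n (λ k → ℕ→ℚ (F (α ℕ.+ 2 ℕ.* k)) *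
      (fibonomial (α ℕ.+ 2 ℕ.* k ℕ.∸ 1) k * fibonomial (α ℕ.+ 2 ℕ.* k ℕ.∸ 1) k)))

{-# OPTIONS --safe #-}
-- Write h a n for the determinant of (1 / F (a + i + j)) with 0 ≤ i, j ≤ n. Subtracting
-- F a / F (a + j) times column 0 from every column j ≥ 1 clears the first row, and by
-- Vajda's identity F (a + i) F (a + j) - F a F (a + i + j) = (-1)^a F i F j the remaining
-- minor is the matrix of h (a + 2) (n - 1) with row i scaled by (-1)^a F (i+1) / F (a+i+1)
-- and column j by F (j+1) / F (a+j+1). So
--   h a (m + 1) = (-1)^((m+1) a) / F a · ∏_{k ≤ m} (F (k+1) / F (a+k+1))² · h (a + 2) m,
-- while the claimed denominator satisfies exactly the reciprocal recursion, since
-- (a+2k+1 choose k+1)_F = (a+2k+1 choose k)_F · F (a+k+1) / F (k+1). Integrality follows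
-- from the Pascal-type recurrence of the Fibonomial coefficients, which rests on
-- F (k + m + 1) = F (k+1) F (m+1) + F k F m.
module Submission where

open import Defs
open import Data.Nat using (ℕ; suc; _≤_)
open import Data.Integer using (ℤ)
open import Data.Rational using (ℚ; _*_; 1ℚ; _/_)
open import Data.Product using (Σ; _×_)
open import Relation.Binary.PropositionalEquality using (_≡_)

open import Level using (0ℓ)
open import Data.Nat.Combinatorics using (_C_; nC1≡n; nCk+nC[k+1]≡[n+1]C[k+1])
open import Data.Nat as ℕ using (zero; _<_; z≤n; s≤s)
import Data.Nat.Properties as ℕₚ
import Data.Nat.Tactic.RingSolver as ℕ-Solver
import Data.Integer as ℤ
import Data.Integer.Properties as ℤₚ
open import Data.Rational using (mkℚ; 0ℚ; _+_; -_; _-_; 1/_)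
import Data.Rational.Properties as ℚₚ
open import Algebra.Properties.Group ℚₚ.+-0-group using () renaming (⁻¹-involutive to neg-involutive)
import Data.Nat.Coprimality as Coprimality
open import Data.Product using (_,_; proj₁)
open import Data.Sum using (inj₁; inj₂)
open import Data.Fin as Fin using (Fin; toℕ)
open import Function using (_∘_)
open import Relation.Binary.PropositionalEquality
open import Relation.Nullary using (yes; no; contradiction)
open import Relation.Binary.Definitions using (tri<; tri≈; tri>)
open import Relation.Nullary.Decidable using (dec⇒maybe)
open import Tactic.RingSolver using (solve-∀)
open import Tactic.RingSolver.Core.AlmostCommutativeRing
  using (AlmostCommutativeRing; fromCommutativeRing)

ℚ-ring : AlmostCommutativeRing 0ℓ 0ℓ
ℚ-ring = fromCommutativeRing ℚₚ.+-*-commutativeRing (λ x → dec⇒maybe (0ℚ ℚₚ.≟ x))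

ℤ→ℚ : ℤ → ℚ
ℤ→ℚ z = z / 1

coprime-1 : ∀ {m} → Coprimality.Coprime m 1
coprime-1 = Coprimality.sym (Coprimality.1-coprimeTo _)

ℤ→ℚ≡mkℚ : ∀ z → ℤ→ℚ z ≡ mkℚ z 0 coprime-1
ℤ→ℚ≡mkℚ z = ℚₚ.↥p/↧p≡p (mkℚ z 0 _)

ℤ→ℚ-+ : ∀ x y → ℤ→ℚ (x ℤ.+ y) ≡ ℤ→ℚ x + ℤ→ℚ y
ℤ→ℚ-+ x y rewrite ℤ→ℚ≡mkℚ x | ℤ→ℚ≡mkℚ y =
  cong (_/ 1) (cong₂ ℤ._+_ (sym (ℤₚ.*-identityʳ x)) (sym (ℤₚ.*-identityʳ y)))

ℤ→ℚ-* : ∀ x y → ℤ→ℚ (x ℤ.* y) ≡ ℤ→ℚ x * ℤ→ℚ y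
ℤ→ℚ-* x y rewrite ℤ→ℚ≡mkℚ x | ℤ→ℚ≡mkℚ y = refl

ℤ→ℚ-neg : ∀ x → ℤ→ℚ (ℤ.- x) ≡ - ℤ→ℚ x
ℤ→ℚ-neg x rewrite ℤ→ℚ≡mkℚ x | ℤ→ℚ≡mkℚ (ℤ.- x) = mkℚ-neg x
  where
  mkℚ-neg : ∀ x → mkℚ (ℤ.- x) 0 coprime-1 ≡ - mkℚ x 0 coprime-1
  mkℚ-neg (ℤ.+ zero) = refl
  mkℚ-neg (ℤ.+ suc n) = refl
  mkℚ-neg ℤ.-[1+ n ] = refl

ℕ→ℚ-+ : ∀ m n → ℕ→ℚ (m ℕ.+ n) ≡ ℕ→ℚ m + ℕ→ℚ n
ℕ→ℚ-+ m n = trans (cong ℤ→ℚ (ℤₚ.pos-+ m n)) (ℤ→ℚ-+ (ℤ.+ m) (ℤ.+ n))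

ℕ→ℚ-* : ∀ m n → ℕ→ℚ (m ℕ.* n) ≡ ℕ→ℚ m * ℕ→ℚ n
ℕ→ℚ-* m n = trans (cong ℤ→ℚ (ℤₚ.pos-* m n)) (ℤ→ℚ-* (ℤ.+ m) (ℤ.+ n))

ℕ→ℚ*recip : ∀ m → ℕ→ℚ (suc m) * recip (suc m) ≡ 1ℚ
ℕ→ℚ*recip m = begin
  ℕ→ℚ (suc m) * recip (suc m)
    ≡⟨ cong₂ _*_ (ℤ→ℚ≡mkℚ (ℤ.+ suc m)) (ℚₚ.↥p/↧p≡p (mkℚ (ℤ.+ 1) m (Coprimality.1-coprimeTo _))) ⟩
  p * 1/ p
    ≡⟨ ℚₚ.*-inverseʳ p ⟩
  1ℚ ∎
  where
  open ≡-Reasoning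
  p = mkℚ (ℤ.+ suc m) 0 coprime-1

-- Determinants of ℕ-indexed matrices

∑ : ℕ → (ℕ → ℚ) → ℚ
∑ zero    g = 0ℚ
∑ (suc n) g = g 0 + ∑ n (g ∘ suc)

∏ : ℕ → (ℕ → ℚ) → ℚ
∏ zero    g = 1ℚ
∏ (suc n) g = g 0 * ∏ n (g ∘ suc)

∑-cong : ∀ n {g h : ℕ → ℚ} → (∀ k → k < n → g k ≡ h k) → ∑ n g ≡ ∑ n h
∑-cong zero    g≡h = refl
∑-cong (suc n) g≡h =
  cong₂ _+_ (g≡h 0 (s≤s z≤n)) (∑-cong n (λ k k<n → g≡h (suc k) (s≤s k<n)))

∑-zero : ∀ n → ∑ n (λ _ → 0ℚ) ≡ 0ℚ
∑-zero zero    = refl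
∑-zero (suc n) = cong (0ℚ +_) (∑-zero n)

∑-neg : ∀ n g → ∑ n (λ k → - g k) ≡ - ∑ n g
∑-neg zero    g = refl
∑-neg (suc n) g = trans (cong (- g 0 +_) (∑-neg n (g ∘ suc))) (sym (ℚₚ.neg-distrib-+ (g 0) _))

∑-+ : ∀ n g h → ∑ n (λ k → g k + h k) ≡ ∑ n g + ∑ n h
∑-+ zero    g h = refl
∑-+ (suc n) g h =
  trans (cong (g 0 + h 0 +_) (∑-+ n (g ∘ suc) (h ∘ suc))) (interchange (g 0) (h 0) _ _)
  where
  interchange : ∀ a b c d → (a + b) + (c + d) ≡ (a + c) + (b + d)
  interchange = solve-∀ ℚ-ring

∑-*ˡ : ∀ n c g → ∑ n (λ k → c * g k) ≡ c * ∑ n g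
∑-*ˡ zero    c g = sym (ℚₚ.*-zeroʳ c)
∑-*ˡ (suc n) c g =
  trans (cong (c * g 0 +_) (∑-*ˡ n c (g ∘ suc))) (sym (ℚₚ.*-distribˡ-+ c (g 0) _))

∏-cong : ∀ n {g h : ℕ → ℚ} → (∀ k → g k ≡ h k) → ∏ n g ≡ ∏ n h
∏-cong zero    g≡h = refl
∏-cong (suc n) g≡h = cong₂ _*_ (g≡h 0) (∏-cong n (g≡h ∘ suc))

∏-* : ∀ n g h → ∏ n (λ k → g k * h k) ≡ ∏ n g * ∏ n h
∏-* zero    g h = refl
∏-* (suc n) g h =
  trans (cong (g 0 * h 0 *_) (∏-* n (g ∘ suc) (h ∘ suc))) (interchange (g 0) (h 0) _ _)
  where
  interchange : ∀ a b c d → (a * b) * (c * d) ≡ (a * c) * (b * d)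
  interchange = solve-∀ ℚ-ring

∏-inverse : ∀ n {g h : ℕ → ℚ} → (∀ k → g k * h k ≡ 1ℚ) → ∏ n g * ∏ n h ≡ 1ℚ
∏-inverse n {g} {h} gh≡1 = begin
  ∏ n g * ∏ n h           ≡⟨ ∏-* n g h ⟨
  ∏ n (λ k → g k * h k)   ≡⟨ ∏-cong n gh≡1 ⟩
  ∏ n (λ _ → 1ℚ)          ≡⟨ ∏-one n ⟩
  1ℚ                      ∎
  where
  open ≡-Reasoning
  ∏-one : ∀ n → ∏ n (λ _ → 1ℚ) ≡ 1ℚ
  ∏-one zero    = refl
  ∏-one (suc n) = cong (1ℚ *_) (∏-one n)

punchIn : ℕ → ℕ → ℕ
punchIn zero    j       = suc j
punchIn (suc k) zero    = zero
punchIn (suc k) (suc j) = suc (punchIn k j)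

punchOut : ℕ → ℕ → ℕ
punchOut zero    j       = ℕ.pred j
punchOut (suc k) zero    = zero
punchOut (suc k) (suc j) = suc (punchOut k j)

punchIn-< : ∀ {n} k j → k < suc n → j < n → punchIn k j < suc n
punchIn-< zero    j       _         j<n       = s≤s j<n
punchIn-< (suc k) zero    _         _         = s≤s z≤n
punchIn-< (suc k) (suc j) (s≤s k<n) (s≤s j<n) = s≤s (punchIn-< k j k<n j<n)

punchIn-injective : ∀ k i j → punchIn k i ≡ punchIn k j → i ≡ j
punchIn-injective zero    i       j       eq = ℕₚ.suc-injective eq
punchIn-injective (suc k) zero    zero    _  = refl
punchIn-injective (suc k) (suc i) (suc j) eq =
  cong suc (punchIn-injective k i j (ℕₚ.suc-injective eq))

punchInₖ≢k : ∀ k j → punchIn k j ≢ k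
punchInₖ≢k (suc k) (suc j) eq = punchInₖ≢k k j (ℕₚ.suc-injective eq)

punchIn-punchOut : ∀ k j → j ≢ k → punchIn k (punchOut k j) ≡ j
punchIn-punchOut zero    zero    j≢k = contradiction refl j≢k
punchIn-punchOut zero    (suc j) _   = refl
punchIn-punchOut (suc k) zero    _   = refl
punchIn-punchOut (suc k) (suc j) j≢k = cong suc (punchIn-punchOut k j (j≢k ∘ cong suc))

punchOut-< : ∀ {n} k j → k < suc n → j < suc n → j ≢ k → punchOut k j < n
punchOut-<         zero    zero    _         _         j≢k = contradiction refl j≢k
punchOut-<         zero    (suc j) _         (s≤s j<n) _   = j<n
punchOut-< {zero}  (suc k) _       (s≤s ())  _         _
punchOut-< {suc n} (suc k) zero    _         _         _   = s≤s z≤n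
punchOut-< {suc n} (suc k) (suc j) (s≤s k<n) (s≤s j<n) j≢k = s≤s (punchOut-< k j k<n j<n (j≢k ∘ cong suc))

swapAdj : ℕ → ℕ → ℕ
swapAdj zero    zero          = 1
swapAdj zero    (suc zero)    = 0
swapAdj zero    (suc (suc k)) = suc (suc k)
swapAdj (suc p) zero          = zero
swapAdj (suc p) (suc k)       = suc (swapAdj p k)

swapAdj-p : ∀ p → swapAdj p p ≡ suc p
swapAdj-p zero    = refl
swapAdj-p (suc p) = cong suc (swapAdj-p p)

swapAdj-1+p : ∀ p → swapAdj p (suc p) ≡ p
swapAdj-1+p zero    = refl
swapAdj-1+p (suc p) = cong suc (swapAdj-1+p p)

swapAdj-< : ∀ p k → k < p → swapAdj p k ≡ k
swapAdj-< (suc p) zero    _         = refl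
swapAdj-< (suc p) (suc k) (s≤s k<p) = cong suc (swapAdj-< p k k<p)

swapAdj-> : ∀ p k → suc p < k → swapAdj p k ≡ k
swapAdj-> zero    (suc zero)    (s≤s ())
swapAdj-> zero    (suc (suc k)) _           = refl
swapAdj-> (suc p) (suc k)       (s≤s sp<k)  = cong suc (swapAdj-> p k sp<k)

swapAdj-punchIn-p : ∀ p j → swapAdj p (punchIn p j) ≡ punchIn (suc p) j
swapAdj-punchIn-p zero    zero    = refl
swapAdj-punchIn-p zero    (suc j) = refl
swapAdj-punchIn-p (suc p) zero    = refl
swapAdj-punchIn-p (suc p) (suc j) = cong suc (swapAdj-punchIn-p p j)

swapAdj-punchIn-1+p : ∀ p j → swapAdj p (punchIn (suc p) j) ≡ punchIn p j
swapAdj-punchIn-1+p zero    zero    = refl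
swapAdj-punchIn-1+p zero    (suc j) = refl
swapAdj-punchIn-1+p (suc p) zero    = refl
swapAdj-punchIn-1+p (suc p) (suc j) = cong suc (swapAdj-punchIn-1+p p j)

swapAdj-punchIn-< : ∀ k p j → k < p → swapAdj p (punchIn k j) ≡ punchIn k (swapAdj (ℕ.pred p) j)
swapAdj-punchIn-< zero    (suc p)       j       _           = refl
swapAdj-punchIn-< (suc k) (suc zero)    j       (s≤s ())
swapAdj-punchIn-< (suc k) (suc (suc p)) zero    _           = refl
swapAdj-punchIn-< (suc k) (suc (suc p)) (suc j) (s≤s k<sp)  = cong suc (swapAdj-punchIn-< k (suc p) j k<sp)

swapAdj-punchIn-> : ∀ k p j → suc p < k → swapAdj p (punchIn k j) ≡ punchIn k (swapAdj p j)
swapAdj-punchIn-> (suc zero)    zero    zero          (s≤s ())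
swapAdj-punchIn-> (suc (suc k)) zero    zero          _          = refl
swapAdj-punchIn-> (suc (suc k)) zero    (suc zero)    _          = refl
swapAdj-punchIn-> (suc (suc k)) zero    (suc (suc j)) _          = refl
swapAdj-punchIn-> (suc k)       (suc p) zero          _          = refl
swapAdj-punchIn-> (suc k)       (suc p) (suc j)       (s≤s sp<k) = cong suc (swapAdj-punchIn-> k p j sp<k)

swapAdj-invariant : ∀ {A : Set} (g : ℕ → A) p → g p ≡ g (suc p) → ∀ j → g (swapAdj p j) ≡ g j
swapAdj-invariant g zero    gp≡gsp zero          = sym gp≡gsp
swapAdj-invariant g zero    gp≡gsp (suc zero)    = gp≡gsp
swapAdj-invariant g zero    gp≡gsp (suc (suc j)) = refl
swapAdj-invariant g (suc p) gp≡gsp zero          = refl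
swapAdj-invariant g (suc p) gp≡gsp (suc j)       = swapAdj-invariant (g ∘ suc) p gp≡gsp j

∑-swapAdj : ∀ n p g → suc p < n → ∑ n (g ∘ swapAdj p) ≡ ∑ n g
∑-swapAdj (suc (suc n)) zero    g _          = swap (g 0) (g 1) _
  where
  swap : ∀ a b c → b + (a + c) ≡ a + (b + c)
  swap = solve-∀ ℚ-ring
∑-swapAdj (suc n)       (suc p) g (s≤s sp<n) = cong (g 0 +_) (∑-swapAdj n p (g ∘ suc) sp<n)

Matrix : Set
Matrix = ℕ → ℕ → ℚ

minor : Matrix → ℕ → Matrix
minor A k i j = A (suc i) (punchIn k j)

-- Only the top-left n × n block of A matters for det′ n A.
det′ : ℕ → Matrix → ℚ
det′ zero    A = 1ℚ
det′ (suc n) A = ∑ (suc n) (λ k → sgn k * (A 0 k * det′ n (minor A k)))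

det′-cong : ∀ n {A B : Matrix} → (∀ i j → i < n → j < n → A i j ≡ B i j) →
            det′ n A ≡ det′ n B
det′-cong zero    A≡B = refl
det′-cong (suc n) A≡B = ∑-cong (suc n) λ k k<n →
  cong (sgn k *_) (cong₂ _*_ (A≡B 0 k (s≤s z≤n) k<n) (det′-cong n λ i j i<n j<n →
    A≡B (suc i) (punchIn k j) (s≤s i<n) (punchIn-< k j k<n j<n)))

det′-swapAdj : ∀ n p → suc p < n → ∀ A → det′ n (λ i j → A i (swapAdj p j)) ≡ - det′ n A
det′-swapAdj (suc n) p sp<n A = begin
  ∑ (suc n) (λ k → sgn k * (A 0 (swapAdj p k) * det′ n (minor A∘s k)))
    ≡⟨ ∑-cong (suc n) term ⟩
  ∑ (suc n) (λ k → - t (swapAdj p k))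
    ≡⟨ ∑-neg (suc n) (t ∘ swapAdj p) ⟩
  - ∑ (suc n) (t ∘ swapAdj p)
    ≡⟨ cong -_ (∑-swapAdj (suc n) p t sp<n) ⟩
  - ∑ (suc n) t ∎
  where
  open ≡-Reasoning
  A∘s : Matrix
  A∘s i j = A i (swapAdj p j)
  t : ℕ → ℚ
  t k = sgn k * (A 0 k * det′ n (minor A k))

  swappedColumn : ∀ k k′ → sgn k′ ≡ - sgn k →
                  (∀ j → swapAdj p (punchIn k j) ≡ punchIn k′ j) →
                  sgn k * (A 0 k′ * det′ n (minor A∘s k)) ≡ - t k′
  swappedColumn k k′ sk′≡-sk s∘punch = begin
    sgn k * (a * det′ n (minor A∘s k))
      ≡⟨ cong (λ d → sgn k * (a * d)) (det′-cong n λ i j _ _ → cong (A (suc i)) (s∘punch j)) ⟩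
    sgn k * (a * d)                     ≡⟨ flip (sgn k) (a * d) ⟩
    - (- sgn k * (a * d))               ≡⟨ cong (λ s → - (s * (a * d))) sk′≡-sk ⟨
    - t k′                              ∎
    where
    a = A 0 k′
    d = det′ n (minor A k′)
    flip : ∀ s x → s * x ≡ - (- s * x)
    flip = solve-∀ ℚ-ring

  otherColumn : ∀ k q → swapAdj p k ≡ k → suc q < n →
                (∀ j → swapAdj p (punchIn k j) ≡ punchIn k (swapAdj q j)) →
                sgn k * (A 0 (swapAdj p k) * det′ n (minor A∘s k)) ≡ - t (swapAdj p k)
  otherColumn k q sk≡k sq<n s∘punch rewrite sk≡k = begin
    sgn k * (A 0 k * det′ n (minor A∘s k))
      ≡⟨ cong (λ d → sgn k * (A 0 k * d)) (det′-cong n λ i j _ _ → cong (A (suc i)) (s∘punch j)) ⟩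
    sgn k * (A 0 k * det′ n (λ i j → minor A k i (swapAdj q j)))
      ≡⟨ cong (λ d → sgn k * (A 0 k * d)) (det′-swapAdj n q sq<n (minor A k)) ⟩
    sgn k * (A 0 k * - det′ n (minor A k))
      ≡⟨ push (sgn k) (A 0 k) _ ⟩
    - t k ∎
    where
    push : ∀ s a d → s * (a * - d) ≡ - (s * (a * d))
    push = solve-∀ ℚ-ring

  term : ∀ k → k < suc n → sgn k * (A 0 (swapAdj p k) * det′ n (minor A∘s k)) ≡ - t (swapAdj p k)
  term k k<n with ℕ.<-cmp k p
  ... | tri≈ _ refl _ rewrite swapAdj-p k = swappedColumn k (suc k) refl (swapAdj-punchIn-p k)
  term k k<n | tri< k<p _ _ =
    otherColumn k (ℕ.pred p) (swapAdj-< p k k<p) (pred-bound k<p sp<n)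
                (λ j → swapAdj-punchIn-< k p j k<p)
    where
    pred-bound : ∀ {k p} → k < p → suc p < suc n → suc (ℕ.pred p) < n
    pred-bound (s≤s _) (s≤s sp<n) = sp<n
  term k k<n | tri> _ _ p<k with ℕ.<-cmp k (suc p)
  ... | tri< k<sp _ _ = contradiction (ℕₚ.<-≤-trans k<sp p<k) (ℕₚ.<-irrefl refl)
  ... | tri≈ _ refl _ rewrite swapAdj-1+p p =
    swappedColumn (suc p) p (sym (neg-involutive (sgn p))) (swapAdj-punchIn-1+p p)
  ... | tri> _ _ sp<k =
    otherColumn k p (swapAdj-> p k sp<k) (ℕₚ.<-≤-trans sp<k (ℕₚ.≤-pred k<n))
                (λ j → swapAdj-punchIn-> k p j sp<k)

x≡-x⇒x≡0 : ∀ x → x ≡ - x → x ≡ 0ℚ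
x≡-x⇒x≡0 x x≡-x = begin
  x              ≡⟨ ℚₚ.*-identityʳ x ⟨
  x * (½ + ½)    ≡⟨ double x ½ ⟩
  ½ * (x + x)    ≡⟨ cong (λ y → ½ * (x + y)) x≡-x ⟩
  ½ * (x + - x)  ≡⟨ cong (½ *_) (ℚₚ.+-inverseʳ x) ⟩
  ½ * 0ℚ         ≡⟨ ℚₚ.*-zeroʳ ½ ⟩
  0ℚ             ∎
  where
  open ≡-Reasoning
  ½ : ℚ
  ½ = ℤ.+ 1 / 2
  double : ∀ x h → x * (h + h) ≡ h * (x + x)
  double = solve-∀ ℚ-ring

det′-equalAdjCols⇒0 : ∀ n p (A : Matrix) → suc p < n → (∀ i → A i p ≡ A i (suc p)) →
                      det′ n A ≡ 0ℚ
det′-equalAdjCols⇒0 n p A sp<n Aₚ≡Aₚ₊₁ = x≡-x⇒x≡0 (det′ n A) (begin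
  det′ n A
    ≡⟨ det′-cong n (λ i j _ _ → swapAdj-invariant (A i) p (Aₚ≡Aₚ₊₁ i) j) ⟨
  det′ n (λ i j → A i (swapAdj p j))
    ≡⟨ det′-swapAdj n p sp<n A ⟩
  - det′ n A ∎)
  where open ≡-Reasoning

det′-equalCol₀⇒0 : ∀ q n (A : Matrix) → suc q < n → (∀ i → A i 0 ≡ A i (suc q)) →
                   det′ n A ≡ 0ℚ
det′-equalCol₀⇒0 zero    n A 1<n    A₀≡A₁  = det′-equalAdjCols⇒0 n 0 A 1<n A₀≡A₁
det′-equalCol₀⇒0 (suc q) n A ssq<n A₀≡Aₛₛq = begin
  det′ n A      ≡⟨ neg-involutive (det′ n A) ⟨
  - - det′ n A  ≡⟨ cong -_ (det′-swapAdj n (suc q) ssq<n A) ⟨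
  - det′ n A∘s  ≡⟨ cong -_ (det′-equalCol₀⇒0 q n A∘s sq<n A∘s₀≡A∘sₛq) ⟩
  - 0ℚ          ≡⟨⟩
  0ℚ            ∎
  where
  open ≡-Reasoning
  A∘s : Matrix
  A∘s i j = A i (swapAdj (suc q) j)
  A∘s₀≡A∘sₛq : ∀ i → A∘s i 0 ≡ A∘s i (suc q)
  A∘s₀≡A∘sₛq i = trans (A₀≡Aₛₛq i) (cong (A i) (sym (swapAdj-p (suc q))))
  sq<n : suc q < n
  sq<n = ℕₚ.<-trans (ℕₚ.n<1+n (suc q)) ssq<n

det′-linearCol : ∀ n c {T B V : Matrix} y → c < n →
  (∀ i j → j ≢ c → T i j ≡ B i j) → (∀ i j → j ≢ c → V i j ≡ B i j) →
  (∀ i → T i c ≡ B i c + y * V i c) →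
  det′ n T ≡ det′ n B + y * det′ n V
det′-linearCol (suc n) c {T} {B} {V} y c<n T≈B V≈B T≡B+yV = begin
  ∑ (suc n) (term T)
    ≡⟨ ∑-cong (suc n) term-linear ⟩
  ∑ (suc n) (λ k → term B k + y * term V k)
    ≡⟨ ∑-+ (suc n) (term B) (λ k → y * term V k) ⟩
  ∑ (suc n) (term B) + ∑ (suc n) (λ k → y * term V k)
    ≡⟨ cong (det′ (suc n) B +_) (∑-*ˡ (suc n) y (term V)) ⟩
  det′ (suc n) B + y * det′ (suc n) V ∎
  where
  open ≡-Reasoning
  term : Matrix → ℕ → ℚ
  term A k = sgn k * (A 0 k * det′ n (minor A k))

  term-linear : ∀ k → k < suc n → term T k ≡ term B k + y * term V k
  term-linear k k<n with k ℕ.≟ c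
  ... | yes refl = begin
    sgn k * (T 0 k * det′ n (minor T k))
      ≡⟨ cong₂ (λ a d → sgn k * (a * d)) (T≡B+yV 0) (minor≈ T≈B) ⟩
    sgn k * ((B 0 k + y * V 0 k) * det′ n (minor B k))
      ≡⟨ distrib (sgn k) (B 0 k) y (V 0 k) _ ⟩
    term B k + y * (sgn k * (V 0 k * det′ n (minor B k)))
      ≡⟨ cong (λ d → term B k + y * (sgn k * (V 0 k * d))) (minor≈ V≈B) ⟨
    term B k + y * term V k ∎
    where
    minor≈ : ∀ {A} → (∀ i j → j ≢ k → A i j ≡ B i j) → det′ n (minor A k) ≡ det′ n (minor B k)
    minor≈ A≈B = det′-cong n λ i j _ _ → A≈B (suc i) (punchIn k j) (punchInₖ≢k k j)
    distrib : ∀ s b y c d → s * ((b + y * c) * d) ≡ s * (b * d) + y * (s * (c * d))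
    distrib = solve-∀ ℚ-ring
  ... | no k≢c = begin
    sgn k * (T 0 k * det′ n (minor T k))
      ≡⟨ cong₂ (λ a d → sgn k * (a * d)) (T≈B 0 k k≢c) minor-linear ⟩
    sgn k * (B 0 k * (det′ n (minor B k) + y * det′ n (minor V k)))
      ≡⟨ distrib (sgn k) (B 0 k) _ y _ ⟩
    term B k + y * (sgn k * (B 0 k * det′ n (minor V k)))
      ≡⟨ cong (λ a → term B k + y * (sgn k * (a * det′ n (minor V k)))) (V≈B 0 k k≢c) ⟨
    term B k + y * term V k ∎
    where
    c≢k : c ≢ k
    c≢k = k≢c ∘ sym
    c′ = punchOut k c
    punchIn-c′ : punchIn k c′ ≡ c
    punchIn-c′ = punchIn-punchOut k c c≢k
    avoids-c : ∀ j → j ≢ c′ → punchIn k j ≢ c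
    avoids-c j j≢c′ eq = j≢c′ (punchIn-injective k j c′ (trans eq (sym punchIn-c′)))
    minor-linear : det′ n (minor T k) ≡ det′ n (minor B k) + y * det′ n (minor V k)
    minor-linear = det′-linearCol n c′ y (punchOut-< k c k<n c<n c≢k)
      (λ i j j≢c′ → T≈B (suc i) (punchIn k j) (avoids-c j j≢c′))
      (λ i j j≢c′ → V≈B (suc i) (punchIn k j) (avoids-c j j≢c′))
      (λ i → subst (λ col → T (suc i) col ≡ B (suc i) col + y * V (suc i) col)
                   (sym punchIn-c′) (T≡B+yV (suc i)))
    distrib : ∀ s b d y e → s * (b * (d + y * e)) ≡ s * (b * d) + y * (s * (b * e))
    distrib = solve-∀ ℚ-ring

∏-punchIn : ∀ n k g → k < suc n → ∏ (suc n) g ≡ g k * ∏ n (g ∘ punchIn k)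
∏-punchIn n       zero    g _         = refl
∏-punchIn (suc n) (suc k) g (s≤s k<n) =
  trans (cong (g 0 *_) (∏-punchIn n k (g ∘ suc) k<n)) (swap (g 0) (g (suc k)) _)
  where
  swap : ∀ a b c → a * (b * c) ≡ b * (a * c)
  swap = solve-∀ ℚ-ring

det′-scale : ∀ n r s B → det′ n (λ i j → r i * (s j * B i j)) ≡ ∏ n r * (∏ n s * det′ n B)
det′-scale zero    r s B = sym (trans (ℚₚ.*-identityˡ _) (ℚₚ.*-identityˡ _))
det′-scale (suc n) r s B = begin
  ∑ (suc n) (λ k → sgn k * ((r 0 * (s k * B 0 k)) * det′ n (minor rsB k)))
    ≡⟨ ∑-cong (suc n) term-scale ⟩
  ∑ (suc n) (λ k → ∏ (suc n) r * (∏ (suc n) s * term k))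
    ≡⟨ ∑-*ˡ (suc n) (∏ (suc n) r) (λ k → ∏ (suc n) s * term k) ⟩
  ∏ (suc n) r * ∑ (suc n) (λ k → ∏ (suc n) s * term k)
    ≡⟨ cong (∏ (suc n) r *_) (∑-*ˡ (suc n) (∏ (suc n) s) term) ⟩
  ∏ (suc n) r * (∏ (suc n) s * det′ (suc n) B) ∎
  where
  open ≡-Reasoning
  rsB : Matrix
  rsB i j = r i * (s j * B i j)
  term : ℕ → ℚ
  term k = sgn k * (B 0 k * det′ n (minor B k))
  term-scale : ∀ k → k < suc n →
    sgn k * ((r 0 * (s k * B 0 k)) * det′ n (minor rsB k)) ≡ ∏ (suc n) r * (∏ (suc n) s * term k)
  term-scale k k<n = begin
    sgn k * ((r 0 * (s k * B 0 k)) * det′ n (minor rsB k))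
      ≡⟨ cong (λ d → sgn k * ((r 0 * (s k * B 0 k)) * d))
              (det′-scale n (r ∘ suc) (s ∘ punchIn k) (minor B k)) ⟩
    sgn k * ((r 0 * (s k * B 0 k)) * (∏ n (r ∘ suc) * (∏ n (s ∘ punchIn k) * det′ n (minor B k))))
      ≡⟨ regroup (sgn k) (r 0) (s k) (B 0 k) _ _ _ ⟩
    (r 0 * ∏ n (r ∘ suc)) * ((s k * ∏ n (s ∘ punchIn k)) * term k)
      ≡⟨ cong (λ p → ∏ (suc n) r * (p * term k)) (∏-punchIn n k s k<n) ⟨
    ∏ (suc n) r * (∏ (suc n) s * term k) ∎
    where
    regroup : ∀ σ r₀ sₖ b R S d →
              σ * ((r₀ * (sₖ * b)) * (R * (S * d))) ≡ (r₀ * R) * ((sₖ * S) * (σ * (b * d)))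
    regroup = solve-∀ ℚ-ring

det′-firstRow : ∀ n (A : Matrix) → (∀ k → k < n → A 0 (suc k) ≡ 0ℚ) →
                det′ (suc n) A ≡ A 0 0 * det′ n (minor A 0)
det′-firstRow n A A₀ₖ≡0 = begin
  1ℚ * (A 0 0 * det′ n (minor A 0)) + ∑ n (λ k → sgn (suc k) * (A 0 (suc k) * det′ n (minor A (suc k))))
    ≡⟨ cong (1ℚ * (A 0 0 * det′ n (minor A 0)) +_) (trans (∑-cong n vanish) (∑-zero n)) ⟩
  1ℚ * (A 0 0 * det′ n (minor A 0)) + 0ℚ
    ≡⟨ trans (ℚₚ.+-identityʳ _) (ℚₚ.*-identityˡ _) ⟩
  A 0 0 * det′ n (minor A 0) ∎
  where
  open ≡-Reasoning
  vanish : ∀ k → k < n → sgn (suc k) * (A 0 (suc k) * det′ n (minor A (suc k))) ≡ 0ℚ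
  vanish k k<n = begin
    sgn (suc k) * (A 0 (suc k) * d)  ≡⟨ cong (λ a → sgn (suc k) * (a * d)) (A₀ₖ≡0 k k<n) ⟩
    sgn (suc k) * (0ℚ * d)           ≡⟨ cong (sgn (suc k) *_) (ℚₚ.*-zeroˡ d) ⟩
    sgn (suc k) * 0ℚ                 ≡⟨ ℚₚ.*-zeroʳ (sgn (suc k)) ⟩
    0ℚ                               ∎
    where d = det′ n (minor A (suc k))

_[_]≔_ : {A : Set} → (ℕ → A) → ℕ → A → ℕ → A
(g [ q ]≔ v) j with j ℕ.≟ q
... | yes _ = v
... | no  _ = g j

[]≔-≡ : ∀ {A : Set} (g : ℕ → A) q v → (g [ q ]≔ v) q ≡ v
[]≔-≡ g q v with q ℕ.≟ q
... | yes _   = refl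
... | no  q≢q = contradiction refl q≢q

[]≔-≢ : ∀ {A : Set} (g : ℕ → A) q v j → j ≢ q → (g [ q ]≔ v) j ≡ g j
[]≔-≢ g q v j j≢q with j ℕ.≟ q
... | yes j≡q = contradiction j≡q j≢q
... | no  _   = refl

det′-addCol₀To : ∀ n q {T B : Matrix} y → suc q < n →
  (∀ i j → j ≢ suc q → T i j ≡ B i j) → (∀ i → T i (suc q) ≡ B i (suc q) + y * B i 0) →
  det′ n T ≡ det′ n B
det′-addCol₀To n q {T} {B} y sq<n T≈B Tₛq = begin
  det′ n T                  ≡⟨ det′-linearCol n (suc q) y sq<n T≈B V≈B Tₛq′ ⟩
  det′ n B + y * det′ n V
    ≡⟨ cong (λ d → det′ n B + y * d) (det′-equalCol₀⇒0 q n V sq<n V₀≡Vₛq) ⟩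
  det′ n B + y * 0ℚ
    ≡⟨ trans (cong (det′ n B +_) (ℚₚ.*-zeroʳ y)) (ℚₚ.+-identityʳ _) ⟩
  det′ n B                  ∎
  where
  open ≡-Reasoning
  V : Matrix
  V i = B i [ suc q ]≔ B i 0
  V≈B : ∀ i j → j ≢ suc q → V i j ≡ B i j
  V≈B i j = []≔-≢ (B i) (suc q) (B i 0) j
  Tₛq′ : ∀ i → T i (suc q) ≡ B i (suc q) + y * V i (suc q)
  Tₛq′ i = trans (Tₛq i) (cong (λ b → B i (suc q) + y * b) (sym ([]≔-≡ (B i) (suc q) (B i 0))))
  V₀≡Vₛq : ∀ i → V i 0 ≡ V i (suc q)
  V₀≡Vₛq i = trans ([]≔-≢ (B i) (suc q) (B i 0) 0 (λ ())) (sym ([]≔-≡ (B i) (suc q) (B i 0)))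

addCol₀ : (ℕ → ℚ) → Matrix → Matrix
addCol₀ l A i j = A i j + l j * A i 0

det′-addCol₀ : ∀ n l (A : Matrix) → l 0 ≡ 0ℚ → det′ (suc n) (addCol₀ l A) ≡ det′ (suc n) A
det′-addCol₀ n l A l₀≡0 =
  upTo n l (ℕₚ.n<1+n n) l₀≡0 (λ j n<j j<sn → contradiction (ℕₚ.<-≤-trans j<sn n<j) (ℕₚ.<-irrefl refl))
  where
  open ≡-Reasoning
  unchanged : ∀ l i j → l j ≡ 0ℚ → addCol₀ l A i j ≡ A i j
  unchanged l i j lⱼ≡0 = trans (cong (λ c → A i j + c * A i 0) lⱼ≡0)
                               (trans (cong (A i j +_) (ℚₚ.*-zeroˡ (A i 0))) (ℚₚ.+-identityʳ (A i j)))
  upTo : ∀ t l → t < suc n → l 0 ≡ 0ℚ → (∀ j → t < j → j < suc n → l j ≡ 0ℚ) →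
         det′ (suc n) (addCol₀ l A) ≡ det′ (suc n) A
  upTo zero    l _      l₀≡0 l≡0 = det′-cong (suc n) {addCol₀ l A} {A} λ where
    i zero    _ _    → unchanged l i 0 l₀≡0
    i (suc j) _ j<sn → unchanged l i (suc j) (l≡0 (suc j) (s≤s z≤n) j<sn)
  upTo (suc t) l st<sn l₀≡0 l≡0 = begin
    det′ (suc n) (addCol₀ l A)   ≡⟨ det′-addCol₀To (suc n) t (l (suc t)) st<sn T≈B Tₛₜ ⟩
    det′ (suc n) (addCol₀ l′ A)  ≡⟨ upTo t l′ (ℕₚ.<-trans (ℕₚ.n<1+n t) st<sn) l′₀≡0 l′≡0 ⟩
    det′ (suc n) A               ∎
    where
    l′ = l [ suc t ]≔ 0ℚ
    l′₀≡0 : l′ 0 ≡ 0ℚ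
    l′₀≡0 = trans ([]≔-≢ l (suc t) 0ℚ 0 (λ ())) l₀≡0
    l′≡0 : ∀ j → t < j → j < suc n → l′ j ≡ 0ℚ
    l′≡0 j t<j j<sn with ℕₚ.m≤n⇒m<n∨m≡n t<j
    ... | inj₁ st<j = trans ([]≔-≢ l (suc t) 0ℚ j (λ j≡st → ℕₚ.<-irrefl (sym j≡st) st<j)) (l≡0 j st<j j<sn)
    ... | inj₂ refl = []≔-≡ l (suc t) 0ℚ
    T≈B : ∀ i j → j ≢ suc t → addCol₀ l A i j ≡ addCol₀ l′ A i j
    T≈B i j j≢st = cong (λ c → A i j + c * A i 0) (sym ([]≔-≢ l (suc t) 0ℚ j j≢st))
    Tₛₜ : ∀ i → addCol₀ l A i (suc t) ≡ addCol₀ l′ A i (suc t) + l (suc t) * addCol₀ l′ A i 0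
    Tₛₜ i = begin
      A i (suc t) + l (suc t) * A i 0
        ≡⟨ cong (λ a → a + l (suc t) * A i 0) (unchanged l′ i (suc t) ([]≔-≡ l (suc t) 0ℚ)) ⟨
      addCol₀ l′ A i (suc t) + l (suc t) * A i 0
        ≡⟨ cong (λ a → addCol₀ l′ A i (suc t) + l (suc t) * a) (unchanged l′ i 0 l′₀≡0) ⟨
      addCol₀ l′ A i (suc t) + l (suc t) * addCol₀ l′ A i 0 ∎

-- Fibonacci identities

fib : ℕ → ℚ
fib n = ℕ→ℚ (F n)

1/fib : ℕ → ℚ
1/fib n = recip (F n)

record FibonacciLike (u : ℕ → ℚ) : Set where
  constructor fibonacciLike
  field step : ∀ n → u (suc (suc n)) ≡ u (suc n) + u n

fib-rec : ∀ n → fib (suc (suc n)) ≡ fib (suc n) + fib n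
fib-rec n = ℕ→ℚ-+ (F (suc n)) (F n)

fib-FibonacciLike : FibonacciLike fib
fib-FibonacciLike = fibonacciLike fib-rec

F[1+n]≡1+ : ∀ n → Σ ℕ λ m → F (suc n) ≡ suc m
F[1+n]≡1+ zero    = 0 , refl
F[1+n]≡1+ (suc n) with F[1+n]≡1+ n
... | m , F[1+n]≡1+m rewrite F[1+n]≡1+m = m ℕ.+ F n , refl

fib*1/fib : ∀ n → 1 ≤ n → fib n * 1/fib n ≡ 1ℚ
fib*1/fib (suc n) _ with F[1+n]≡1+ n
... | m , F[1+n]≡1+m rewrite F[1+n]≡1+m = ℕ→ℚ*recip m

fib*1/fib-+ : ∀ {a} → 1 ≤ a → ∀ n → fib (a ℕ.+ n) * 1/fib (a ℕ.+ n) ≡ 1ℚ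
fib*1/fib-+ {a} 1≤a n = fib*1/fib (a ℕ.+ n) (ℕₚ.≤-trans 1≤a (ℕₚ.m≤m+n a n))

FibonacciLike-unique : ∀ {u v} → FibonacciLike u → FibonacciLike v →
  u 0 ≡ v 0 → u 1 ≡ v 1 → ∀ n → u n ≡ v n
FibonacciLike-unique {u} {v} (fibonacciLike u-rec) (fibonacciLike v-rec) u₀≡v₀ u₁≡v₁ n =
  proj₁ (agree n)
  where
  agree : ∀ n → u n ≡ v n × u (suc n) ≡ v (suc n)
  agree zero    = u₀≡v₀ , u₁≡v₁
  agree (suc n) with agree n
  ... | uₙ≡vₙ , uₙ₊₁≡vₙ₊₁ =
    uₙ₊₁≡vₙ₊₁ , trans (u-rec n) (trans (cong₂ _+_ uₙ₊₁≡vₙ₊₁ uₙ≡vₙ) (sym (v-rec n)))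

FibonacciLike-shift : ∀ {u} → FibonacciLike u → ∀ a → FibonacciLike (λ n → u (a ℕ.+ n))
FibonacciLike.step (FibonacciLike-shift (fibonacciLike u-rec) a) n
  rewrite ℕₚ.+-suc a (suc n) | ℕₚ.+-suc a n = u-rec (a ℕ.+ n)

FibonacciLike-+ʳ : ∀ {u} → FibonacciLike u → ∀ b → FibonacciLike (λ n → u (n ℕ.+ b))
FibonacciLike-+ʳ (fibonacciLike u-rec) b = fibonacciLike (λ n → u-rec (n ℕ.+ b))

FibonacciLike-*ˡ : ∀ {u} → FibonacciLike u → ∀ c → FibonacciLike (λ n → c * u n)
FibonacciLike.step (FibonacciLike-*ˡ {u} (fibonacciLike u-rec) c) n =
  trans (cong (c *_) (u-rec n)) (ℚₚ.*-distribˡ-+ c (u (suc n)) (u n))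

FibonacciLike-*ʳ : ∀ {u} → FibonacciLike u → ∀ c → FibonacciLike (λ n → u n * c)
FibonacciLike.step (FibonacciLike-*ʳ {u} (fibonacciLike u-rec) c) n =
  trans (cong (_* c) (u-rec n)) (ℚₚ.*-distribʳ-+ c (u (suc n)) (u n))

FibonacciLike-- : ∀ {u v} → FibonacciLike u → FibonacciLike v → FibonacciLike (λ n → u n - v n)
FibonacciLike.step (FibonacciLike-- {u} {v} (fibonacciLike u-rec) (fibonacciLike v-rec)) n =
  trans (cong₂ _-_ (u-rec n) (v-rec n)) (interchange (u (suc n)) (u n) (v (suc n)) (v n))
  where
  interchange : ∀ a b c d → (a + b) - (c + d) ≡ (a - c) + (b - d)
  interchange = solve-∀ ℚ-ring

cassini : ∀ a → fib (suc a) * fib (suc a) - fib a * fib (suc (suc a)) ≡ sgn a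
cassini zero    = refl
cassini (suc a) = begin
  fib (2 ℕ.+ a) * fib (2 ℕ.+ a) - x * fib (3 ℕ.+ a)
    ≡⟨ cong (λ w → fib (2 ℕ.+ a) * fib (2 ℕ.+ a) - x * w) (fib-rec (suc a)) ⟩
  fib (2 ℕ.+ a) * fib (2 ℕ.+ a) - x * (fib (2 ℕ.+ a) + x)
    ≡⟨ cong (λ w → w * w - x * (w + x)) (fib-rec a) ⟩
  (x + y) * (x + y) - x * ((x + y) + x)
    ≡⟨ expand x y ⟩
  - (x * x - y * (x + y))
    ≡⟨ cong (λ w → - (x * x - y * w)) (fib-rec a) ⟨
  - (x * x - y * fib (2 ℕ.+ a))
    ≡⟨ cong -_ (cassini a) ⟩
  - sgn a ∎
  where
  open ≡-Reasoning
  x = fib (suc a)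
  y = fib a
  expand : ∀ x y → (x + y) * (x + y) - x * ((x + y) + x) ≡ - (x * x - y * (x + y))
  expand = solve-∀ ℚ-ring

dOcagne : ∀ a j → fib (a ℕ.+ j) * fib (suc a) - fib a * fib (suc a ℕ.+ j) ≡ sgn a * fib j
dOcagne a = FibonacciLike-unique lhs-rec rhs-rec at0 at1
  where
  lhs-rec : FibonacciLike (λ j → fib (a ℕ.+ j) * fib (suc a) - fib a * fib (suc a ℕ.+ j))
  lhs-rec = FibonacciLike-- (FibonacciLike-*ʳ (FibonacciLike-shift fib-FibonacciLike a) (fib (suc a)))
                            (FibonacciLike-*ˡ (FibonacciLike-shift fib-FibonacciLike (suc a)) (fib a))
  rhs-rec : FibonacciLike (λ j → sgn a * fib j)
  rhs-rec = FibonacciLike-*ˡ fib-FibonacciLike (sgn a)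
  at0 : fib (a ℕ.+ 0) * fib (suc a) - fib a * fib (suc a ℕ.+ 0) ≡ sgn a * fib 0
  at0 rewrite ℕₚ.+-identityʳ a = cancel (fib a) (fib (suc a)) (sgn a)
    where
    cancel : ∀ x y s → x * y - x * y ≡ s * 0ℚ
    cancel = solve-∀ ℚ-ring
  at1 : fib (a ℕ.+ 1) * fib (suc a) - fib a * fib (suc a ℕ.+ 1) ≡ sgn a * fib 1
  at1 rewrite ℕₚ.+-comm a 1 = trans (cassini a) (sym (ℚₚ.*-identityʳ (sgn a)))

vajda : ∀ a i j →
  fib (a ℕ.+ j) * fib (a ℕ.+ i) - fib a * fib (a ℕ.+ i ℕ.+ j) ≡ sgn a * (fib i * fib j)
vajda a i j = FibonacciLike-unique lhs-rec rhs-rec at0 at1 i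
  where
  lhs-rec : FibonacciLike (λ i → fib (a ℕ.+ j) * fib (a ℕ.+ i) - fib a * fib (a ℕ.+ i ℕ.+ j))
  lhs-rec = FibonacciLike-- (FibonacciLike-*ˡ (FibonacciLike-shift fib-FibonacciLike a) (fib (a ℕ.+ j)))
                            (FibonacciLike-*ˡ (FibonacciLike-shift (FibonacciLike-+ʳ fib-FibonacciLike j) a) (fib a))
  rhs-rec : FibonacciLike (λ i → sgn a * (fib i * fib j))
  rhs-rec = FibonacciLike-*ˡ (FibonacciLike-*ʳ fib-FibonacciLike (fib j)) (sgn a)
  at0 : fib (a ℕ.+ j) * fib (a ℕ.+ 0) - fib a * fib (a ℕ.+ 0 ℕ.+ j) ≡ sgn a * (fib 0 * fib j)
  at0 rewrite ℕₚ.+-identityʳ a = cancel (fib (a ℕ.+ j)) (fib a) (sgn a) (fib j)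
    where
    cancel : ∀ x y s z → x * y - y * x ≡ s * (0ℚ * z)
    cancel = solve-∀ ℚ-ring
  at1 : fib (a ℕ.+ j) * fib (a ℕ.+ 1) - fib a * fib (a ℕ.+ 1 ℕ.+ j) ≡ sgn a * (fib 1 * fib j)
  at1 rewrite ℕₚ.+-comm a 1 = trans (dOcagne a j) (cong (sgn a *_) (sym (ℚₚ.*-identityˡ (fib j))))

1/fib-vajda : ∀ a i j → 1 ≤ a →
  1/fib (a ℕ.+ i ℕ.+ j) - fib a * (1/fib (a ℕ.+ i) * 1/fib (a ℕ.+ j))
    ≡ sgn a * (fib i * fib j) * (1/fib (a ℕ.+ i) * (1/fib (a ℕ.+ j) * 1/fib (a ℕ.+ i ℕ.+ j)))
1/fib-vajda a i j 1≤a = begin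
  Z - fib a * (X * Y)
    ≡⟨ pad X Y Z (fib a) ⟩
  Z * 1ℚ * 1ℚ - fib a * (X * Y) * 1ℚ
    ≡⟨ cong₂ (λ u v → Z * u * 1ℚ - fib a * (X * Y) * v)
             (fib*1/fib-+ 1≤a j) (fib*1/fib-+ (ℕₚ.≤-trans 1≤a (ℕₚ.m≤m+n a i)) j) ⟨
  Z * (y * Y) * 1ℚ - fib a * (X * Y) * (z * Z)
    ≡⟨ cong (λ u → Z * (y * Y) * u - fib a * (X * Y) * (z * Z)) (fib*1/fib-+ 1≤a i) ⟨
  Z * (y * Y) * (x * X) - fib a * (X * Y) * (z * Z)
    ≡⟨ factor x y z X Y Z (fib a) ⟩
  (y * x - fib a * z) * (X * (Y * Z))
    ≡⟨ cong (_* (X * (Y * Z))) (vajda a i j) ⟩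
  sgn a * (fib i * fib j) * (X * (Y * Z)) ∎
  where
  open ≡-Reasoning
  x = fib (a ℕ.+ i)
  y = fib (a ℕ.+ j)
  z = fib (a ℕ.+ i ℕ.+ j)
  X = 1/fib (a ℕ.+ i)
  Y = 1/fib (a ℕ.+ j)
  Z = 1/fib (a ℕ.+ i ℕ.+ j)
  pad : ∀ X Y Z f → Z - f * (X * Y) ≡ Z * 1ℚ * 1ℚ - f * (X * Y) * 1ℚ
  pad = solve-∀ ℚ-ring
  factor : ∀ x y z X Y Z f →
           Z * (y * Y) * (x * X) - f * (X * Y) * (z * Z) ≡ (y * x - f * z) * (X * (Y * Z))
  factor = solve-∀ ℚ-ring

-- The Hankel determinant

sgn-+ : ∀ m n → sgn (m ℕ.+ n) ≡ sgn m * sgn n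
sgn-+ zero    n = sym (ℚₚ.*-identityˡ (sgn n))
sgn-+ (suc m) n = trans (cong -_ (sgn-+ m n)) (ℚₚ.neg-distribˡ-* (sgn m) (sgn n))

sgn*sgn : ∀ n → sgn n * sgn n ≡ 1ℚ
sgn*sgn zero    = refl
sgn*sgn (suc n) = trans (neg*neg (sgn n)) (sgn*sgn n)
  where
  neg*neg : ∀ s → - s * - s ≡ s * s
  neg*neg = solve-∀ ℚ-ring

sgn-2* : ∀ n → sgn (2 ℕ.* n) ≡ 1ℚ
sgn-2* n =
  trans (sgn-+ n (n ℕ.+ 0)) (trans (cong (λ m → sgn n * sgn m) (ℕₚ.+-identityʳ n)) (sgn*sgn n))

∏-sgn : ∀ n a → ∏ n (λ _ → sgn a) ≡ sgn (n ℕ.* a)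
∏-sgn zero    a = refl
∏-sgn (suc n) a = trans (cong (sgn a *_) (∏-sgn n a)) (sym (sgn-+ a (n ℕ.* a)))

hankel : ℕ → Matrix
hankel a i j = 1/fib (a ℕ.+ i ℕ.+ j)

ratio ratio⁻¹ : ℕ → ℕ → ℚ
ratio   a k = fib (a ℕ.+ suc k) * 1/fib (suc k)
ratio⁻¹ a k = fib (suc k) * 1/fib (a ℕ.+ suc k)

ratio*ratio⁻¹ : ∀ {a} → 1 ≤ a → ∀ k → ratio a k * ratio⁻¹ a k ≡ 1ℚ
ratio*ratio⁻¹ {a} 1≤a k = begin
  (x * Y) * (y * X)  ≡⟨ regroup x Y y X ⟩
  (x * X) * (y * Y)  ≡⟨ cong₂ _*_ (fib*1/fib-+ 1≤a (suc k)) (fib*1/fib (suc k) (s≤s z≤n)) ⟩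
  1ℚ * 1ℚ            ≡⟨⟩
  1ℚ                 ∎
  where
  open ≡-Reasoning
  x = fib (a ℕ.+ suc k)
  X = 1/fib (a ℕ.+ suc k)
  y = fib (suc k)
  Y = 1/fib (suc k)
  regroup : ∀ x Y y X → (x * Y) * (y * X) ≡ (x * X) * (y * Y)
  regroup = solve-∀ ℚ-ring

hankel-step : ∀ a m → 1 ≤ a →
  det′ (suc (suc m)) (hankel a)
    ≡ 1/fib a * (sgn (suc m ℕ.* a) *
        (∏ (suc m) (ratio⁻¹ a) * (∏ (suc m) (ratio⁻¹ a) * det′ (suc m) (hankel (a ℕ.+ 2)))))
hankel-step a m 1≤a = begin
  det′ (suc (suc m)) (hankel a)
    ≡⟨ det′-addCol₀ (suc m) coeff (hankel a) refl ⟨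
  det′ (suc (suc m)) H
    ≡⟨ det′-firstRow (suc m) H (λ k _ → firstRow k) ⟩
  H 0 0 * det′ (suc m) (minor H 0)
    ≡⟨ cong₂ _*_ corner (det′-cong (suc m) (λ i j _ _ → minor-entry i j)) ⟩
  1/fib a * det′ (suc m) (λ i j → (sgn a * ratio⁻¹ a i) * (ratio⁻¹ a j * hankel (a ℕ.+ 2) i j))
    ≡⟨ cong (1/fib a *_) (det′-scale (suc m) (λ i → sgn a * ratio⁻¹ a i) (ratio⁻¹ a) (hankel (a ℕ.+ 2))) ⟩
  1/fib a * (∏ (suc m) (λ i → sgn a * ratio⁻¹ a i) * (P⁻¹ * h′))
    ≡⟨ cong (λ p → 1/fib a * (p * (P⁻¹ * h′)))
            (trans (∏-* (suc m) (λ _ → sgn a) (ratio⁻¹ a)) (cong (_* P⁻¹) (∏-sgn (suc m) a))) ⟩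
  1/fib a * ((sgn (suc m ℕ.* a) * P⁻¹) * (P⁻¹ * h′))
    ≡⟨ cong (1/fib a *_) (ℚₚ.*-assoc (sgn (suc m ℕ.* a)) P⁻¹ (P⁻¹ * h′)) ⟩
  1/fib a * (sgn (suc m ℕ.* a) * (P⁻¹ * (P⁻¹ * h′))) ∎
  where
  open ≡-Reasoning
  P⁻¹ = ∏ (suc m) (ratio⁻¹ a)
  h′ = det′ (suc m) (hankel (a ℕ.+ 2))

  coeff : ℕ → ℚ
  coeff zero    = 0ℚ
  coeff (suc j) = - (fib a * 1/fib (a ℕ.+ suc j))

  H : Matrix
  H = addCol₀ coeff (hankel a)

  entry : ∀ i j → H i (suc j)
    ≡ sgn a * (fib i * fib (suc j)) * (1/fib (a ℕ.+ i) * (1/fib (a ℕ.+ suc j) * 1/fib (a ℕ.+ i ℕ.+ suc j)))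
  entry i j = begin
    Z + - (fib a * Y) * 1/fib (a ℕ.+ i ℕ.+ 0)
      ≡⟨ cong (λ k → Z + - (fib a * Y) * 1/fib k) (ℕₚ.+-identityʳ (a ℕ.+ i)) ⟩
    Z + - (fib a * Y) * X
      ≡⟨ reorder Z (fib a) X Y ⟩
    Z - fib a * (X * Y)
      ≡⟨ 1/fib-vajda a i (suc j) 1≤a ⟩
    sgn a * (fib i * fib (suc j)) * (X * (Y * Z)) ∎
    where
    X = 1/fib (a ℕ.+ i)
    Y = 1/fib (a ℕ.+ suc j)
    Z = 1/fib (a ℕ.+ i ℕ.+ suc j)
    reorder : ∀ Z f X Y → Z + - (f * Y) * X ≡ Z - f * (X * Y)
    reorder = solve-∀ ℚ-ring

  firstRow : ∀ k → H 0 (suc k) ≡ 0ℚ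
  firstRow k = trans (entry 0 k) (vanish (sgn a) (fib (suc k)) _)
    where
    vanish : ∀ s y w → s * (0ℚ * y) * w ≡ 0ℚ
    vanish = solve-∀ ℚ-ring

  corner : H 0 0 ≡ 1/fib a
  corner = begin
    1/fib (a ℕ.+ 0 ℕ.+ 0) + 0ℚ * 1/fib (a ℕ.+ 0 ℕ.+ 0)
      ≡⟨ cong (λ k → 1/fib k + 0ℚ * 1/fib k) (trans (ℕₚ.+-identityʳ (a ℕ.+ 0)) (ℕₚ.+-identityʳ a)) ⟩
    1/fib a + 0ℚ * 1/fib a
      ≡⟨ trans (cong (1/fib a +_) (ℚₚ.*-zeroˡ (1/fib a))) (ℚₚ.+-identityʳ (1/fib a)) ⟩
    1/fib a ∎

  minor-entry : ∀ i j → minor H 0 i j ≡ (sgn a * ratio⁻¹ a i) * (ratio⁻¹ a j * hankel (a ℕ.+ 2) i j)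
  minor-entry i j = begin
    H (suc i) (suc j)
      ≡⟨ entry (suc i) j ⟩
    σ * (X * (Y * 1/fib (a ℕ.+ suc i ℕ.+ suc j)))
      ≡⟨ cong (λ k → σ * (X * (Y * 1/fib k))) (index a i j) ⟩
    σ * (X * (Y * 1/fib (a ℕ.+ 2 ℕ.+ i ℕ.+ j)))
      ≡⟨ regroup (sgn a) (fib (suc i)) (fib (suc j)) X Y _ ⟩
    (sgn a * ratio⁻¹ a i) * (ratio⁻¹ a j * hankel (a ℕ.+ 2) i j) ∎
    where
    σ = sgn a * (fib (suc i) * fib (suc j))
    X = 1/fib (a ℕ.+ suc i)
    Y = 1/fib (a ℕ.+ suc j)
    index : ∀ a i j → a ℕ.+ suc i ℕ.+ suc j ≡ a ℕ.+ 2 ℕ.+ i ℕ.+ j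
    index = ℕ-Solver.solve-∀
    regroup : ∀ s p q X Y Z → s * (p * q) * (X * (Y * Z)) ≡ (s * (p * X)) * ((q * Y) * Z)
    regroup = solve-∀ ℚ-ring

-- The claimed denominator

∏-snoc : ∀ n g → ∏ (suc n) g ≡ ∏ n g * g n
∏-snoc zero    g = trans (ℚₚ.*-identityʳ (g 0)) (sym (ℚₚ.*-identityˡ (g 0)))
∏-snoc (suc n) g = trans (cong (g 0 *_) (∏-snoc n (g ∘ suc))) (sym (ℚₚ.*-assoc (g 0) _ _))

prod1≡∏ : ∀ m h → prod1 m h ≡ ∏ m (h ∘ suc)
prod1≡∏ zero    h = refl
prod1≡∏ (suc m) h = trans (cong (_* h (suc m)) (prod1≡∏ m h)) (sym (∏-snoc m (h ∘ suc)))

rhsFactor : ℕ → ℕ → ℚ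
rhsFactor a k =
  fib (a ℕ.+ 2 ℕ.* k) * (fibonomial (a ℕ.+ 2 ℕ.* k ℕ.∸ 1) k * fibonomial (a ℕ.+ 2 ℕ.* k ℕ.∸ 1) k)

rhsFactor-step : ∀ a k → rhsFactor a (suc k) ≡ rhsFactor (a ℕ.+ 2) k * (ratio a k * ratio a k)
rhsFactor-step a k = begin
  fib N * (fibonomial (N ℕ.∸ 1) (suc k) * fibonomial (N ℕ.∸ 1) (suc k))
    ≡⟨ cong (λ c → fib N * (c * c)) (cong (λ t → fibonomial (N ℕ.∸ 1) k * (fib t * 1/fib (suc k))) top) ⟩
  fib N * ((fibonomial (N ℕ.∸ 1) k * ratio a k) * (fibonomial (N ℕ.∸ 1) k * ratio a k))
    ≡⟨ regroup (fib N) (fibonomial (N ℕ.∸ 1) k) (ratio a k) ⟩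
  fib N * (fibonomial (N ℕ.∸ 1) k * fibonomial (N ℕ.∸ 1) k) * (ratio a k * ratio a k)
    ≡⟨ cong (λ n → fib n * (fibonomial (n ℕ.∸ 1) k * fibonomial (n ℕ.∸ 1) k) * (ratio a k * ratio a k))
            shift ⟩
  rhsFactor (a ℕ.+ 2) k * (ratio a k * ratio a k) ∎
  where
  open ≡-Reasoning
  N = a ℕ.+ 2 ℕ.* suc k
  shift : N ≡ a ℕ.+ 2 ℕ.+ 2 ℕ.* k
  shift = reassoc a k
    where
    reassoc : ∀ a k → a ℕ.+ 2 ℕ.* suc k ≡ a ℕ.+ 2 ℕ.+ 2 ℕ.* k
    reassoc = ℕ-Solver.solve-∀
  top : N ℕ.∸ 1 ℕ.∸ suc k ℕ.+ 1 ≡ a ℕ.+ suc k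
  top = begin
    N ℕ.∸ 1 ℕ.∸ suc k ℕ.+ 1
      ≡⟨ cong (λ n → n ℕ.∸ 1 ℕ.∸ suc k ℕ.+ 1) (expand a k) ⟩
    (a ℕ.+ k) ℕ.+ suc k ℕ.∸ suc k ℕ.+ 1
      ≡⟨ cong (ℕ._+ 1) (ℕₚ.m+n∸n≡m (a ℕ.+ k) (suc k)) ⟩
    a ℕ.+ k ℕ.+ 1
      ≡⟨ trans (ℕₚ.+-assoc a k 1) (cong (a ℕ.+_) (ℕₚ.+-comm k 1)) ⟩
    a ℕ.+ suc k ∎
    where
    expand : ∀ a k → a ℕ.+ 2 ℕ.* suc k ≡ suc ((a ℕ.+ k) ℕ.+ suc k)
    expand = ℕ-Solver.solve-∀
  regroup : ∀ f c r → f * ((c * r) * (c * r)) ≡ f * (c * c) * (r * r)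
  regroup = solve-∀ ℚ-ring

sgn-C₂-step : ∀ a m →
  sgn (a ℕ.* (suc (suc m) C 2)) ≡ sgn (suc m ℕ.* a) * sgn ((a ℕ.+ 2) ℕ.* (suc m C 2))
sgn-C₂-step a m = begin
  sgn (a ℕ.* (suc (suc m) C 2))          ≡⟨ cong (λ c → sgn (a ℕ.* c)) pascal ⟨
  sgn (a ℕ.* (suc m ℕ.+ c))              ≡⟨ cong sgn (distrib a (suc m) c) ⟩
  sgn (suc m ℕ.* a ℕ.+ a ℕ.* c)          ≡⟨ sgn-+ (suc m ℕ.* a) (a ℕ.* c) ⟩
  sgn (suc m ℕ.* a) * sgn (a ℕ.* c)      ≡⟨ cong (sgn (suc m ℕ.* a) *_) even-shift ⟨
  sgn (suc m ℕ.* a) * sgn ((a ℕ.+ 2) ℕ.* c) ∎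
  where
  open ≡-Reasoning
  c = suc m C 2
  pascal : suc m ℕ.+ c ≡ suc (suc m) C 2
  pascal = trans (cong (ℕ._+ c) (sym (nC1≡n (suc m)))) (nCk+nC[k+1]≡[n+1]C[k+1] (suc m) 1)
  distrib : ∀ a n c → a ℕ.* (n ℕ.+ c) ≡ n ℕ.* a ℕ.+ a ℕ.* c
  distrib = ℕ-Solver.solve-∀
  even-shift : sgn ((a ℕ.+ 2) ℕ.* c) ≡ sgn (a ℕ.* c)
  even-shift = begin
    sgn ((a ℕ.+ 2) ℕ.* c)            ≡⟨ cong sgn (ℕₚ.*-distribʳ-+ c a 2) ⟩
    sgn (a ℕ.* c ℕ.+ 2 ℕ.* c)        ≡⟨ sgn-+ (a ℕ.* c) (2 ℕ.* c) ⟩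
    sgn (a ℕ.* c) * sgn (2 ℕ.* c)    ≡⟨ cong (sgn (a ℕ.* c) *_) (sgn-2* c) ⟩
    sgn (a ℕ.* c) * 1ℚ               ≡⟨ ℚₚ.*-identityʳ (sgn (a ℕ.* c)) ⟩
    sgn (a ℕ.* c)                    ∎

rhsFactors-step : ∀ a m → prod1 (suc m) (rhsFactor a)
  ≡ (fib (a ℕ.+ 2) * prod1 m (rhsFactor (a ℕ.+ 2))) * (∏ (suc m) (ratio a) * ∏ (suc m) (ratio a))
rhsFactors-step a m = begin
  prod1 (suc m) (rhsFactor a)
    ≡⟨ prod1≡∏ (suc m) (rhsFactor a) ⟩
  ∏ (suc m) (rhsFactor a ∘ suc)
    ≡⟨ ∏-cong (suc m) (rhsFactor-step a) ⟩
  ∏ (suc m) (λ k → rhsFactor (a ℕ.+ 2) k * (ratio a k * ratio a k))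
    ≡⟨ ∏-* (suc m) (rhsFactor (a ℕ.+ 2)) (λ k → ratio a k * ratio a k) ⟩
  ∏ (suc m) (rhsFactor (a ℕ.+ 2)) * ∏ (suc m) (λ k → ratio a k * ratio a k)
    ≡⟨ cong₂ _*_ (cong₂ _*_ first (sym (prod1≡∏ m (rhsFactor (a ℕ.+ 2)))))
                 (∏-* (suc m) (ratio a) (ratio a)) ⟩
  (fib (a ℕ.+ 2) * prod1 m (rhsFactor (a ℕ.+ 2))) * (∏ (suc m) (ratio a) * ∏ (suc m) (ratio a)) ∎
  where
  open ≡-Reasoning
  first : rhsFactor (a ℕ.+ 2) 0 ≡ fib (a ℕ.+ 2)
  first = trans (ℚₚ.*-identityʳ _) (cong fib (ℕₚ.+-identityʳ (a ℕ.+ 2)))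

rhsDenominator-step : ∀ a m → rhsDenominator a (suc m)
  ≡ sgn (suc m ℕ.* a) *
      (fib a * ((∏ (suc m) (ratio a) * ∏ (suc m) (ratio a)) * rhsDenominator (a ℕ.+ 2) m))
rhsDenominator-step a m = begin
  sgn (a ℕ.* (suc (suc m) C 2)) * (fib a * prod1 (suc m) (rhsFactor a))
    ≡⟨ cong₂ (λ s p → s * (fib a * p)) (sgn-C₂-step a m) (rhsFactors-step a m) ⟩
  (S * S′) * (fib a * ((fib (a ℕ.+ 2) * Q) * (P * P)))
    ≡⟨ regroup S S′ (fib a) (fib (a ℕ.+ 2)) Q (P * P) ⟩
  S * (fib a * ((P * P) * (S′ * (fib (a ℕ.+ 2) * Q)))) ∎
  where
  open ≡-Reasoning
  S = sgn (suc m ℕ.* a)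
  S′ = sgn ((a ℕ.+ 2) ℕ.* (suc m C 2))
  P = ∏ (suc m) (ratio a)
  Q = prod1 m (rhsFactor (a ℕ.+ 2))
  regroup : ∀ S S′ f f′ Q PP →
            (S * S′) * (f * ((f′ * Q) * PP)) ≡ S * (f * (PP * (S′ * (f′ * Q))))
  regroup = solve-∀ ℚ-ring

hankel*rhsDenominator : ∀ n a → 1 ≤ a → det′ (suc n) (hankel a) * rhsDenominator a n ≡ 1ℚ
hankel*rhsDenominator zero a 1≤a = begin
  det′ 1 (hankel a) * rhsDenominator a 0
    ≡⟨ cong₂ _*_ (det′-firstRow 0 (hankel a) (λ _ ()))
                 (cong (λ e → sgn e * (fib a * 1ℚ)) (ℕₚ.*-zeroʳ a)) ⟩
  (1/fib (a ℕ.+ 0 ℕ.+ 0) * 1ℚ) * (1ℚ * (fib a * 1ℚ))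
    ≡⟨ cong (λ k → (1/fib k * 1ℚ) * (1ℚ * (fib a * 1ℚ)))
            (trans (ℕₚ.+-identityʳ (a ℕ.+ 0)) (ℕₚ.+-identityʳ a)) ⟩
  (1/fib a * 1ℚ) * (1ℚ * (fib a * 1ℚ))
    ≡⟨ simplify (1/fib a) (fib a) ⟩
  fib a * 1/fib a
    ≡⟨ fib*1/fib a 1≤a ⟩
  1ℚ ∎
  where
  open ≡-Reasoning
  simplify : ∀ r f → (r * 1ℚ) * (1ℚ * (f * 1ℚ)) ≡ f * r
  simplify = solve-∀ ℚ-ring
hankel*rhsDenominator (suc m) a 1≤a = begin
  det′ (suc (suc m)) (hankel a) * rhsDenominator a (suc m)
    ≡⟨ cong₂ _*_ (hankel-step a m 1≤a) (rhsDenominator-step a m) ⟩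
  (1/fib a * (S * (P⁻¹ * (P⁻¹ * h′)))) * (S * (fib a * ((P * P) * r′)))
    ≡⟨ regroup (1/fib a) S P⁻¹ h′ (fib a) P r′ ⟩
  (fib a * 1/fib a) * ((S * S) * ((P * P⁻¹) * ((P * P⁻¹) * (h′ * r′))))
    ≡⟨ cong₂ _*_ (fib*1/fib a 1≤a)
         (cong₂ _*_ (sgn*sgn (suc m ℕ.* a)) (cong₂ _*_ P*P⁻¹ (cong₂ _*_ P*P⁻¹ IH))) ⟩
  1ℚ * (1ℚ * (1ℚ * (1ℚ * 1ℚ))) ≡⟨⟩
  1ℚ ∎
  where
  open ≡-Reasoning
  S = sgn (suc m ℕ.* a)
  P = ∏ (suc m) (ratio a)
  P⁻¹ = ∏ (suc m) (ratio⁻¹ a)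
  h′ = det′ (suc m) (hankel (a ℕ.+ 2))
  r′ = rhsDenominator (a ℕ.+ 2) m
  P*P⁻¹ : P * P⁻¹ ≡ 1ℚ
  P*P⁻¹ = ∏-inverse (suc m) {ratio a} {ratio⁻¹ a} (ratio*ratio⁻¹ 1≤a)
  IH : h′ * r′ ≡ 1ℚ
  IH = hankel*rhsDenominator m (a ℕ.+ 2) (ℕₚ.≤-trans 1≤a (ℕₚ.m≤m+n a 2))
  regroup : ∀ R S P⁻¹ h f P r → (R * (S * (P⁻¹ * (P⁻¹ * h)))) * (S * (f * ((P * P) * r)))
                               ≡ (f * R) * ((S * S) * ((P * P⁻¹) * ((P * P⁻¹) * (h * r))))
  regroup = solve-∀ ℚ-ring

-- Integrality of the Fibonomial coefficients

F-+ : ∀ k m → F (suc (k ℕ.+ m)) ≡ F (suc k) ℕ.* F (suc m) ℕ.+ F k ℕ.* F m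
F-+ zero    m = unit (F (suc m)) (F m)
  where
  unit : ∀ x y → x ≡ 1 ℕ.* x ℕ.+ 0 ℕ.* y
  unit = ℕ-Solver.solve-∀
F-+ (suc k) m = begin
  F (suc (suc k ℕ.+ m))
    ≡⟨ cong (F ∘ suc) (ℕₚ.+-suc k m) ⟨
  F (suc (k ℕ.+ suc m))
    ≡⟨ F-+ k (suc m) ⟩
  F (suc k) ℕ.* (F (suc m) ℕ.+ F m) ℕ.+ F k ℕ.* F (suc m)
    ≡⟨ regroup (F (suc k)) (F k) (F (suc m)) (F m) ⟩
  (F (suc k) ℕ.+ F k) ℕ.* F (suc m) ℕ.+ F (suc k) ℕ.* F m ∎
  where
  open ≡-Reasoning
  regroup : ∀ a b x y → a ℕ.* (x ℕ.+ y) ℕ.+ b ℕ.* x ≡ (a ℕ.+ b) ℕ.* x ℕ.+ a ℕ.* y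
  regroup = ℕ-Solver.solve-∀

fibFactorial : ℕ → ℕ
fibFactorial zero    = 1
fibFactorial (suc n) = fibFactorial n ℕ.* F (suc n)

fibFactorial≡1+ : ∀ n → Σ ℕ λ p → fibFactorial n ≡ suc p
fibFactorial≡1+ zero = 0 , refl
fibFactorial≡1+ (suc n) with fibFactorial≡1+ n | F[1+n]≡1+ n
... | p , eq | q , eq′ rewrite eq | eq′ = q ℕ.+ p ℕ.* suc q , refl

-- fibonomialℕ k m is the Fibonomial coefficient (k + m choose k), via its Pascal-type recurrence
fibonomialℕ : ℕ → ℕ → ℕ
fibonomialℕ zero    m       = 1
fibonomialℕ (suc k) zero    = 1
fibonomialℕ (suc k) (suc m) =
  F (suc (suc k)) ℕ.* fibonomialℕ (suc k) m ℕ.+ F m ℕ.* fibonomialℕ k (suc m)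

fibonomialℕ-spec : ∀ k m →
  fibonomialℕ k m ℕ.* fibFactorial k ℕ.* fibFactorial m ≡ fibFactorial (k ℕ.+ m)
fibonomialℕ-spec zero    m       = ℕₚ.+-identityʳ (fibFactorial m)
fibonomialℕ-spec (suc k) zero    =
  trans (ℕₚ.*-identityʳ _) (trans (ℕₚ.+-identityʳ _) (cong fibFactorial (sym (ℕₚ.+-identityʳ (suc k)))))
fibonomialℕ-spec (suc k) (suc m) = begin
  (F (suc (suc k)) ℕ.* fibonomialℕ (suc k) m ℕ.+ F m ℕ.* fibonomialℕ k (suc m))
    ℕ.* (Qₖ ℕ.* F (suc k)) ℕ.* (Qₘ ℕ.* F (suc m))
    ≡⟨ regroup (F (suc (suc k))) (fibonomialℕ (suc k) m) (F m) (fibonomialℕ k (suc m))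
               Qₖ (F (suc k)) Qₘ (F (suc m)) ⟩
  F (suc (suc k)) ℕ.* F (suc m) ℕ.* (fibonomialℕ (suc k) m ℕ.* (Qₖ ℕ.* F (suc k)) ℕ.* Qₘ)
    ℕ.+ F (suc k) ℕ.* F m ℕ.* (fibonomialℕ k (suc m) ℕ.* Qₖ ℕ.* (Qₘ ℕ.* F (suc m)))
    ≡⟨ cong₂ (λ x y → F (suc (suc k)) ℕ.* F (suc m) ℕ.* x ℕ.+ F (suc k) ℕ.* F m ℕ.* y)
         (fibonomialℕ-spec (suc k) m) (trans (fibonomialℕ-spec k (suc m)) (cong fibFactorial (ℕₚ.+-suc k m))) ⟩
  F (suc (suc k)) ℕ.* F (suc m) ℕ.* Q ℕ.+ F (suc k) ℕ.* F m ℕ.* Q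
    ≡⟨ factor (F (suc (suc k)) ℕ.* F (suc m)) (F (suc k) ℕ.* F m) Q ⟩
  Q ℕ.* (F (suc (suc k)) ℕ.* F (suc m) ℕ.+ F (suc k) ℕ.* F m)
    ≡⟨ cong (Q ℕ.*_) (F-+ (suc k) m) ⟨
  fibFactorial (suc (suc k ℕ.+ m))
    ≡⟨ cong (fibFactorial ∘ suc) (ℕₚ.+-suc k m) ⟨
  fibFactorial (suc k ℕ.+ suc m) ∎
  where
  open ≡-Reasoning
  Qₖ = fibFactorial k
  Qₘ = fibFactorial m
  Q = fibFactorial (suc k ℕ.+ m)
  regroup : ∀ a b c d q fk r fm → (a ℕ.* b ℕ.+ c ℕ.* d) ℕ.* (q ℕ.* fk) ℕ.* (r ℕ.* fm)
    ≡ a ℕ.* fm ℕ.* (b ℕ.* (q ℕ.* fk) ℕ.* r) ℕ.+ fk ℕ.* c ℕ.* (d ℕ.* q ℕ.* (r ℕ.* fm))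
  regroup = ℕ-Solver.solve-∀
  factor : ∀ x y q → x ℕ.* q ℕ.+ y ℕ.* q ≡ q ℕ.* (x ℕ.+ y)
  factor = ℕ-Solver.solve-∀

fibonomial-spec : ∀ k m →
  fibonomial (k ℕ.+ m) k * ℕ→ℚ (fibFactorial k) * ℕ→ℚ (fibFactorial m) ≡ ℕ→ℚ (fibFactorial (k ℕ.+ m))
fibonomial-spec zero    m = ℚₚ.*-identityˡ (ℕ→ℚ (fibFactorial m))
fibonomial-spec (suc k) m = begin
  fibonomial (suc k ℕ.+ m) (suc k) * ℕ→ℚ (Qₖ ℕ.* F (suc k)) * ℕ→ℚ Qₘ
    ≡⟨ cong₂ (λ b q → b * q * ℕ→ℚ Qₘ) last-factor (ℕ→ℚ-* Qₖ (F (suc k))) ⟩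
  G * (fib (suc m) * 1/fib (suc k)) * (ℕ→ℚ Qₖ * fib (suc k)) * ℕ→ℚ Qₘ
    ≡⟨ regroup G (fib (suc m)) (1/fib (suc k)) (ℕ→ℚ Qₖ) (fib (suc k)) (ℕ→ℚ Qₘ) ⟩
  G * ℕ→ℚ Qₖ * (ℕ→ℚ Qₘ * fib (suc m)) * (fib (suc k) * 1/fib (suc k))
    ≡⟨ cong₂ (λ q u → G * ℕ→ℚ Qₖ * q * u) (sym (ℕ→ℚ-* Qₘ (F (suc m)))) (fib*1/fib (suc k) (s≤s z≤n)) ⟩
  G * ℕ→ℚ Qₖ * ℕ→ℚ (fibFactorial (suc m)) * 1ℚ
    ≡⟨ ℚₚ.*-identityʳ _ ⟩
  G * ℕ→ℚ Qₖ * ℕ→ℚ (fibFactorial (suc m))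
    ≡⟨ fibonomial-spec k (suc m) ⟩
  ℕ→ℚ (fibFactorial (k ℕ.+ suc m))
    ≡⟨ cong (ℕ→ℚ ∘ fibFactorial) (ℕₚ.+-suc k m) ⟩
  ℕ→ℚ (fibFactorial (suc k ℕ.+ m)) ∎
  where
  open ≡-Reasoning
  Qₖ = fibFactorial k
  Qₘ = fibFactorial m
  G = fibonomial (k ℕ.+ suc m) k
  last-factor : fibonomial (suc k ℕ.+ m) (suc k) ≡ G * (fib (suc m) * 1/fib (suc k))
  last-factor = cong₂ (λ n t → fibonomial n k * (fib t * 1/fib (suc k))) (sym (ℕₚ.+-suc k m))
                      (trans (cong (ℕ._+ 1) (ℕₚ.m+n∸m≡n (suc k) m)) (ℕₚ.+-comm m 1))
  regroup : ∀ G fm r q fk qm → G * (fm * r) * (q * fk) * qm ≡ G * q * (qm * fm) * (fk * r)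
  regroup = solve-∀ ℚ-ring

*-cancelʳ-ℕ→ℚ-suc : ∀ p {x y} → x * ℕ→ℚ (suc p) ≡ y * ℕ→ℚ (suc p) → x ≡ y
*-cancelʳ-ℕ→ℚ-suc p {x} {y} eq = begin
  x                                   ≡⟨ ℚₚ.*-identityʳ x ⟨
  x * 1ℚ                              ≡⟨ cong (x *_) (ℕ→ℚ*recip p) ⟨
  x * (ℕ→ℚ (suc p) * recip (suc p))   ≡⟨ ℚₚ.*-assoc x _ _ ⟨
  x * ℕ→ℚ (suc p) * recip (suc p)     ≡⟨ cong (_* recip (suc p)) eq ⟩
  y * ℕ→ℚ (suc p) * recip (suc p)     ≡⟨ ℚₚ.*-assoc y _ _ ⟩
  y * (ℕ→ℚ (suc p) * recip (suc p))   ≡⟨ cong (y *_) (ℕ→ℚ*recip p) ⟩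
  y * 1ℚ                              ≡⟨ ℚₚ.*-identityʳ y ⟩
  y                                   ∎
  where open ≡-Reasoning

*-cancelʳ-fibFactorial : ∀ n {x y} →
  x * ℕ→ℚ (fibFactorial n) ≡ y * ℕ→ℚ (fibFactorial n) → x ≡ y
*-cancelʳ-fibFactorial n eq with fibFactorial≡1+ n
... | p , Qₙ≡1+p rewrite Qₙ≡1+p = *-cancelʳ-ℕ→ℚ-suc p eq

fibonomial≡fibonomialℕ : ∀ k m → fibonomial (k ℕ.+ m) k ≡ ℕ→ℚ (fibonomialℕ k m)
fibonomial≡fibonomialℕ k m = *-cancelʳ-fibFactorial k (*-cancelʳ-fibFactorial m (begin
  fibonomial (k ℕ.+ m) k * ℕ→ℚ Qₖ * ℕ→ℚ Qₘ   ≡⟨ fibonomial-spec k m ⟩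
  ℕ→ℚ (fibFactorial (k ℕ.+ m))               ≡⟨ cong ℕ→ℚ (fibonomialℕ-spec k m) ⟨
  ℕ→ℚ (fibonomialℕ k m ℕ.* Qₖ ℕ.* Qₘ)         ≡⟨ ℕ→ℚ-* (fibonomialℕ k m ℕ.* Qₖ) Qₘ ⟩
  ℕ→ℚ (fibonomialℕ k m ℕ.* Qₖ) * ℕ→ℚ Qₘ       ≡⟨ cong (_* ℕ→ℚ Qₘ) (ℕ→ℚ-* (fibonomialℕ k m) Qₖ) ⟩
  ℕ→ℚ (fibonomialℕ k m) * ℕ→ℚ Qₖ * ℕ→ℚ Qₘ     ∎))
  where
  open ≡-Reasoning
  Qₖ = fibFactorial k
  Qₘ = fibFactorial m

IsInteger : ℚ → Set
IsInteger q = Σ ℤ λ z → q ≡ z / 1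

IsInteger-* : ∀ {p q} → IsInteger p → IsInteger q → IsInteger (p * q)
IsInteger-* (x , p≡x) (y , q≡y) = x ℤ.* y , trans (cong₂ _*_ p≡x q≡y) (sym (ℤ→ℚ-* x y))

IsInteger-ℕ→ℚ : ∀ m → IsInteger (ℕ→ℚ m)
IsInteger-ℕ→ℚ m = ℤ.+ m , refl

IsInteger-sgn : ∀ m → IsInteger (sgn m)
IsInteger-sgn zero    = ℤ.+ 1 , refl
IsInteger-sgn (suc m) with IsInteger-sgn m
... | z , sgn≡z = ℤ.- z , trans (cong -_ sgn≡z) (sym (ℤ→ℚ-neg z))

IsInteger-prod1 : ∀ m h → (∀ k → IsInteger (h k)) → IsInteger (prod1 m h)
IsInteger-prod1 zero    h _     = ℤ.+ 1 , refl
IsInteger-prod1 (suc m) h h-int = IsInteger-* (IsInteger-prod1 m h h-int) (h-int (suc m))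

rhsDenominator-integer : ∀ a n → 1 ≤ a → IsInteger (rhsDenominator a n)
rhsDenominator-integer (suc a) n _ =
  IsInteger-* (IsInteger-sgn (suc a ℕ.* (suc n C 2)))
    (IsInteger-* (IsInteger-ℕ→ℚ (F (suc a))) (IsInteger-prod1 n (rhsFactor (suc a)) factor))
  where
  fibonomial-integer : ∀ k → IsInteger (fibonomial (suc a ℕ.+ 2 ℕ.* k ℕ.∸ 1) k)
  fibonomial-integer k = ℤ.+ fibonomialℕ k (a ℕ.+ k) ,
    trans (cong (λ N → fibonomial N k) (index a k)) (fibonomial≡fibonomialℕ k (a ℕ.+ k))
    where
    index : ∀ a k → a ℕ.+ 2 ℕ.* k ≡ k ℕ.+ (a ℕ.+ k)
    index = ℕ-Solver.solve-∀
  factor : ∀ k → IsInteger (rhsFactor (suc a) k)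
  factor k = IsInteger-* (IsInteger-ℕ→ℚ (F (suc a ℕ.+ 2 ℕ.* k)))
                         (IsInteger-* (fibonomial-integer k) (fibonomial-integer k))

-- Comparison with the Fin-indexed determinant

toℕ-punchIn : ∀ {n} (j : Fin (suc n)) (k : Fin n) → toℕ (Fin.punchIn j k) ≡ punchIn (toℕ j) (toℕ k)
toℕ-punchIn Fin.zero    k           = refl
toℕ-punchIn (Fin.suc j) Fin.zero    = refl
toℕ-punchIn (Fin.suc j) (Fin.suc k) = cong suc (toℕ-punchIn j k)

sumFin≡∑ : ∀ n (g : Fin n → ℚ) (h : ℕ → ℚ) → (∀ j → g j ≡ h (toℕ j)) → sumFin g ≡ ∑ n h
sumFin≡∑ zero    g h g≡h = refl
sumFin≡∑ (suc n) g h g≡h =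
  cong₂ _+_ (g≡h Fin.zero) (sumFin≡∑ n (g ∘ Fin.suc) (h ∘ suc) (g≡h ∘ Fin.suc))

det≡det′ : ∀ n (M : Fin n → Fin n → ℚ) (A : Matrix) → (∀ i j → M i j ≡ A (toℕ i) (toℕ j)) →
           det n M ≡ det′ n A
det≡det′ zero    M A M≡A = refl
det≡det′ (suc n) M A M≡A = sumFin≡∑ (suc n) _ (λ k → sgn k * (A 0 k * det′ n (minor A k))) λ j →
  cong (sgn (toℕ j) *_) (cong₂ _*_ (M≡A Fin.zero j) (det≡det′ n _ (minor A (toℕ j)) λ i k →
    trans (M≡A (Fin.suc i) (Fin.punchIn j k)) (cong (A (suc (toℕ i))) (toℕ-punchIn j k))))

corollary3p3 : (α n : ℕ) → 1 ≤ α →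
    (det (suc n) (hankelMatrix α n) * rhsDenominator α n ≡ 1ℚ)
    × Σ ℤ (λ z → rhsDenominator α n ≡ z / 1)
corollary3p3 α n 1≤α =
  trans (cong (_* rhsDenominator α n) (det≡det′ (suc n) (hankelMatrix α n) (hankel α) (λ _ _ → refl)))
        (hankel*rhsDenominator n α 1≤α)
  , rhsDenominator-integer α n 1≤α
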